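{- Let $\mathcal{M}=(\Delta,M)$ be a saturated matching configuration and let $\mathcal{Y}=(\Delta,T)$ be the coherent closure of $M$. Then $\mathcal{Y}$ is semiregular (every element of $T$ is a matching) and the fibers of $\mathcal{Y}$ coincide with the fibers of $\mathcal{M}$.
   Context: For relations $r,s$ on $\Delta$: $r^*=\{(\beta,\alpha):(\alpha,\beta)\in r\}$, $\alpha r=\{\beta:(\alpha,\beta)\in r\}$, $1_\Lambda=\{(\alpha,\alpha):\alpha\in\Lambda\}$. A partial coherent configuration is a pair $(\Delta,M)$ where $M$ is a partition of a subset of $\Delta\times\Delta$ such that $1_\Delta$ is a union of elements of $M$, $M^*=M$, and for all $r,s,t\in M$ the number $|\alpha r\cap\beta s^*|$ does not depend on $(\alpha,\beta)\in t$; its fibers are the sets $\Lambda$ with $1_\Lambda\in M$. If $M$ partitions $\Delta\times\Delta$ it is a coherent configuration. A matching is a relation $\{(\alpha,f(\alpha)):\alpha\in\Lambda\}$ for a bijection $f:\Lambda\to\Lambda'$. Let the fibers of $\mathcal{M}$ be $\Delta_x$, $x\in X$; let $M(x,y)$ be the set of elements of $M$ contained in $\Delta_x\times\Delta_y$, $1_x=1_{\Delta_x}$, and $x\sim y$ mean that $M(x,y)$ is a partition of $\Delta_x\times\Delta_y$ into matchings. $\mathcal{M}$ is a matching configuration if for all $x,y$ with $M(x,y)\ne\varnothing$, either $x\sim y$, or $x=y$ and $M(x,x)=\{1_x\}$; it is saturated if for every $Y\subseteq X$ with $|Y|\le 4$ there is $z\in X$ with $z\sim y$ for all $y\in Y$.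 The coherent closure of $M$ is the smallest coherent configuration $(\Delta,T)$ such that every element of $M$ is a union of elements of $T$. -}

module Defs where

open import Data.Nat using (ℕ; zero; suc; _+_; _≤_)
open import Data.Fin using (Fin; zero; suc)
open import Data.Bool using (Bool; true; false; T; _∧_; if_then_else_)
open import Data.Product using (Σ; ∃; ∃-syntax; _×_; _,_; proj₁)
open import Data.Sum using (_⊎_)
open import Data.List using (List; length)
open import Data.List.Membership.Propositional using (_∈_)
open import Relation.Binary.PropositionalEquality using (_≡_)
open import Relation.Nullary using (¬_)
open import Relation.Nullary.Decidable using (⌊_⌋)
import Data.Fin as F
open import Function.Bundles using (_⇔_)
open import Function.Definitions using (Injective; Surjective)

-- The ground set Δ is Fin n.  Subsets of Δ and relations on Δ are
-- Boolean-valued (hence decidable) predicates.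
Subset : ℕ → Set
Subset n = Fin n → Bool

Rel : ℕ → Set
Rel n = Fin n → Fin n → Bool

_∋_,_ : ∀ {n} → Rel n → Fin n → Fin n → Set
r ∋ a , b = T (r a b)

count : ∀ {n} → Subset n → ℕ
count {zero}  P = 0
count {suc n} P = (if P zero then 1 else 0) + count (λ i → P (suc i))

_* : ∀ {n} → Rel n → Rel n
(r *) a b = r b a

-- |α r ∩ β s*|  =  #{γ : (α,γ) ∈ r and (γ,β) ∈ s}
interNum : ∀ {n} → Rel n → Rel n → Fin n → Fin n → ℕ
interNum r s a b = count (λ c → r a c ∧ s c b)

_≐_ : ∀ {n} → Rel n → Rel n → Set
r ≐ s = ∀ a b → (r ∋ a , b) ⇔ (s ∋ a , b)

IsDiag : ∀ {n} → Rel n → Subset n → Set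
IsDiag r Λ = ∀ a b → (r ∋ a , b) ⇔ (a ≡ b × T (Λ a))

-- a family of relations (indexed by Fin m) representing a set of relations
Family : ℕ → ℕ → Set
Family n m = Fin m → Rel n

IsUnionOf : ∀ {n m} → Rel n → Family n m → Set
IsUnionOf {n} {m} s R =
  Σ (Fin m → Bool) λ S → ∀ a b → (s ∋ a , b) ⇔ (∃[ i ] (T (S i) × (R i ∋ a , b)))

IsPartialPartition : ∀ {n m} → Family n m → Set
IsPartialPartition {n} {m} R =
  (∀ i → ∃[ a ] ∃[ b ] (R i ∋ a , b)) ×
  (∀ i j a b → R i ∋ a , b → R j ∋ a , b → i ≡ j)

Covers : ∀ {n m} → Family n m → Set
Covers {n} {m} R = ∀ (a b : Fin n) → ∃[ i ] (R i ∋ a , b)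

one : ∀ {n} → Rel n
one a b = ⌊ a F.≟ b ⌋

record IsPartialCC {n m : ℕ} (R : Family n m) : Set where
  field
    partition : IsPartialPartition R
    diagUnion : IsUnionOf one R
    symm      : ∀ i → ∃[ j ] (R j ≐ (R i *))
    interReg  : ∀ i j k a b a' b' → R k ∋ a , b → R k ∋ a' , b' →
                interNum (R i) (R j) a b ≡ interNum (R i) (R j) a' b'

record IsCC {n m : ℕ} (R : Family n m) : Set where
  field
    partialCC : IsPartialCC R
    covers    : Covers R

IsFiberSet : ∀ {n m} → Family n m → Subset n → Set
IsFiberSet {n} {m} R Λ = ∃[ i ] IsDiag (R i) Λ

-- the element R i of M is itself of the form 1_Λ (i "is" a fiber x ∈ X)
IsFiber : ∀ {n m} → Family n m → Fin m → Set
IsFiber R i = ∃[ Λ ] IsDiag (R i) Λ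

-- r is contained in Λ × Λ', where Λ, Λ' are the fibers given by R x, R y
InBlock : ∀ {n m} → Family n m → Fin m → Fin m → Rel n → Set
InBlock R x y r = ∀ a b → r ∋ a , b → (R x ∋ a , a) × (R y ∋ b , b)

Elem : ∀ {n} → Subset n → Set
Elem Λ = Σ _ λ a → T (Λ a)

IsMatching : ∀ {n} → Rel n → Set
IsMatching {n} r =
  Σ (Subset n) λ Λ → Σ (Subset n) λ Λ' → Σ (Elem Λ → Elem Λ') λ f →
    Injective _≡_ _≡_ f × Surjective _≡_ _≡_ f ×
    (∀ a b → (r ∋ a , b) ⇔ (Σ (T (Λ a)) λ p → proj₁ (f (a , p)) ≡ b))

_∣_∼_ : ∀ {n m} → Family n m → Fin m → Fin m → Set
_∣_∼_ {n} {m} R x y =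
  (∀ a b → R x ∋ a , a → R y ∋ b , b → ∃[ i ] (InBlock R x y (R i) × (R i ∋ a , b))) ×
  (∀ i → InBlock R x y (R i) → IsMatching (R i))

record IsMatchingConfiguration {n m : ℕ} (R : Family n m) : Set where
  field
    partialCC : IsPartialCC R
    matching  : ∀ x y → IsFiber R x → IsFiber R y →
                ∃[ i ] InBlock R x y (R i) →
                (R ∣ x ∼ y) ⊎ (x ≡ y × (∀ i → InBlock R x x (R i) → i ≡ x))

IsSaturated : ∀ {n m} → Family n m → Set
IsSaturated {n} {m} R =
  (Y : List (Fin m)) → length Y ≤ 4 → (∀ y → y ∈ Y → IsFiber R y) →
  ∃[ z ] (IsFiber R z × (∀ y → y ∈ Y → R ∣ z ∼ y))

Refines : ∀ {n m k} → Family n k → Family n m → Set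
Refines {n} {m} {k} S R = ∀ i → IsUnionOf (R i) S

IsCoherentClosure : ∀ {n m k} → Family n k → Family n m → Set
IsCoherentClosure {n} {m} {k} S R =
  IsCC S × Refines S R ×
  (∀ {k'} (S' : Family n k') → IsCC S' → Refines S' R → Refines S' S)

module Submission where

-- In a matching configuration every basis relation is a
-- matching, so two pairs (α , β) and (α' , β') can be compared by looking
-- for sources γ, γ' and relations i, j with (γ , α), (γ' , α') ∈ i and
-- (γ , β), (γ' , β') ∈ j ("congruent" pairs).  Using saturation (a common
-- neighbour for any four points) congruence is shown to be an equivalence
-- relation whose classes are matchings and form a coherent configuration
-- refining M.  Conversely, transferring a common source inside the
-- coherent closure T shows that every element of T lies inside one
-- congruence class; minimality of T gives the reverse inclusion.  Hence
-- the elements of T are exactly the congruence classes, which yields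
-- semiregularity, and the diagonal classes are the fibers of M.

open import Defs
open import Data.Nat using (ℕ; zero; suc; z≤n; s≤s)
open import Data.Fin using (Fin; zero; suc)
import Data.Fin as F
open import Data.Fin.Properties using (any?; suc-injective; 0≢1+n)
open import Data.Bool using (true; false; T; _∧_)
open import Data.Bool.Properties using (T?; T-∧; T-irrelevant)
open import Data.Product using (Σ; ∃-syntax; _×_; _,_; proj₁; proj₂)
open import Data.Sum using (inj₁; inj₂)
open import Data.Empty using (⊥-elim)
open import Data.List using (List; []; _∷_; length; lookup; cartesianProduct; allFin)
open import Data.List.Membership.Propositional using (_∈_)
open import Data.List.Membership.Propositional.Properties using (∈-allFin; ∈-cartesianProduct⁺)
open import Data.List.Relation.Unary.Any using (here; there)
open import Relation.Binary.PropositionalEquality using (_≡_; _≢_; refl; sym; trans; cong; subst)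
open import Relation.Nullary using (¬_; Dec; yes; no)
open import Relation.Nullary.Decidable using (⌊_⌋; toWitness; fromWitness; map′; _×-dec_)
open import Function.Bundles using (_⇔_; Equivalence; mk⇔)
open import Function.Definitions using (Injective; Surjective)
import Function.Properties.Equivalence as ⇔

open Equivalence using (to; from)

count≢0 : ∀ {n} (P : Subset n) c → T (P c) → count P ≢ 0
count≢0 {suc n} P zero p with P zero
... | true = λ ()
count≢0 {suc n} P (suc c) p with P zero
... | true  = λ ()
... | false = count≢0 (λ i → P (suc i)) c p

count≢0⇒member : ∀ {n} (P : Subset n) → count P ≢ 0 → ∃[ c ] T (P c)
count≢0⇒member {zero}  P h = ⊥-elim (h refl)
count≢0⇒member {suc n} P h with P zero in eq
... | true  = zero , subst T (sym eq) _
... | false with count≢0⇒member (λ i → P (suc i)) h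
...   | c , p = suc c , p

count-empty : ∀ {n} (P : Subset n) → (∀ c → ¬ T (P c)) → count P ≡ 0
count-empty {zero}  P h = refl
count-empty {suc n} P h with P zero in eq
... | true  = ⊥-elim (h zero (subst T (sym eq) _))
... | false = count-empty (λ i → P (suc i)) (λ c → h (suc c))

count-singleton : ∀ {n} (P : Subset n) c → T (P c) → (∀ c' → T (P c') → c' ≡ c) → count P ≡ 1
count-singleton {suc n} P zero p only with P zero
... | true = cong suc (count-empty (λ i → P (suc i)) (λ c q → 0≢1+n (sym (only (suc c) q))))
count-singleton {suc n} P (suc c) p only with P zero in eq
... | true  = ⊥-elim (0≢1+n (only zero (subst T (sym eq) _)))
... | false = count-singleton (λ i → P (suc i)) c p (λ c' q → suc-injective (only (suc c') q))

AtMostOne : ∀ {n} → Subset n → Set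
AtMostOne P = ∀ {c c'} → T (P c) → T (P c') → c ≡ c'

-- Subsets with at most one element have equal sizes as soon as they are
-- inhabited together; this computes intersection numbers of matchings.
count-cong-atMostOne : ∀ {n} (P Q : Subset n) → AtMostOne P → AtMostOne Q →
  (∃[ c ] T (P c) → ∃[ d ] T (Q d)) → (∃[ d ] T (Q d) → ∃[ c ] T (P c)) →
  count P ≡ count Q
count-cong-atMostOne P Q P≤1 Q≤1 P⇒Q Q⇒P with any? (λ c → T? (P c))
... | yes (c , p) =
  let (d , q) = P⇒Q (c , p) in
  trans (count-singleton P c p (λ _ p' → P≤1 p' p)) (sym (count-singleton Q d q (λ _ q' → Q≤1 q' q)))
... | no ¬P =
  trans (count-empty P (λ c p → ¬P (c , p))) (sym (count-empty Q (λ d q → ¬P (Q⇒P (d , q)))))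

Functional : ∀ {n} → Rel n → Set
Functional r = ∀ {a b b'} → r ∋ a , b → r ∋ a , b' → b ≡ b'

Cofunctional : ∀ {n} → Rel n → Set
Cofunctional r = ∀ {a a' b} → r ∋ a , b → r ∋ a' , b → a ≡ a'

elem-≡ : ∀ {n} {Λ : Subset n} {e e' : Elem Λ} → proj₁ e ≡ proj₁ e' → e ≡ e'
elem-≡ {e = a , p} {.a , q} refl = cong (a ,_) (T-irrelevant p q)

matching⇒functional : ∀ {n} {r : Rel n} → IsMatching r → Functional r × Cofunctional r
matching⇒functional {r = r} (Λ , Λ' , f , f-inj , _ , graph) = functional , cofunctional
  where
  functional : Functional r
  functional {a} {b} {b'} h h' with to (graph a b) h | to (graph a b') h'
  ... | p , fa≡b | p' , fa≡b' rewrite T-irrelevant p p' = trans (sym fa≡b) fa≡b'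
  cofunctional : Cofunctional r
  cofunctional {a} {a'} {b} h h' with to (graph a b) h | to (graph a' b) h'
  ... | p , fa≡b | p' , fa'≡b = cong proj₁ (f-inj {a , p} {a' , p'} (elem-≡ (trans fa≡b (sym fa'≡b))))

functional⇒matching : ∀ {n} (r : Rel n) → Functional r → Cofunctional r → IsMatching r
functional⇒matching {n} r functional cofunctional = dom , img , f , f-inj , f-surj , graph
  where
  dom img : Subset n
  dom a = ⌊ any? (λ b → T? (r a b)) ⌋
  img b = ⌊ any? (λ a → T? (r a b)) ⌋
  image : ∀ {a} → T (dom a) → ∃[ b ] r ∋ a , b
  image {a} = toWitness {a? = any? (λ b → T? (r a b))}
  preimage : ∀ {b} → T (img b) → ∃[ a ] r ∋ a , b
  preimage {b} = toWitness {a? = any? (λ a → T? (r a b))}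
  inImg : ∀ {a b} → r ∋ a , b → T (img b)
  inImg {a} {b} h = fromWitness {a? = any? (λ a → T? (r a b))} (a , h)
  inDom : ∀ {a b} → r ∋ a , b → T (dom a)
  inDom {a} {b} h = fromWitness {a? = any? (λ b → T? (r a b))} (b , h)
  f : Elem dom → Elem img
  f (a , p) = proj₁ (image p) , inImg (proj₂ (image p))
  f-inj : Injective _≡_ _≡_ f
  f-inj {a , p} {a' , p'} fa≡fa' =
    elem-≡ (cofunctional (proj₂ (image p))
      (subst (λ b → r ∋ a' , b) (sym (cong proj₁ fa≡fa')) (proj₂ (image p'))))
  f-surj : Surjective _≡_ _≡_ f
  f-surj (b , q) with preimage q
  ... | a , h = (a , inDom h) , λ { refl → elem-≡ (functional (proj₂ (image (inDom h))) h) }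
  graph : ∀ a b → (r ∋ a , b) ⇔ Σ (T (dom a)) λ p → proj₁ (f (a , p)) ≡ b
  graph a b = mk⇔ (λ h → inDom h , functional (proj₂ (image (inDom h))) h)
                  (λ { (p , refl) → proj₂ (image p) })

≐-sym : ∀ {n} {r s : Rel n} → r ≐ s → s ≐ r
≐-sym r≐s a b = ⇔.sym (r≐s a b)

isDiag-resp-≐ : ∀ {n} {r s : Rel n} {Λ : Subset n} → r ≐ s → IsDiag r Λ → IsDiag s Λ
isDiag-resp-≐ r≐s d a b = ⇔.trans (⇔.sym (r≐s a b)) (d a b)

one⇒≡ : ∀ {n} {a b : Fin n} → T (one a b) → a ≡ b
one⇒≡ {a = a} {b} = toWitness {a? = a F.≟ b}

≡⇒one : ∀ {n} {a b : Fin n} → a ≡ b → T (one a b)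
≡⇒one {a = a} {b} = fromWitness {a? = a F.≟ b}

refinement-⊆ : ∀ {n m k} {R : Family n m} {S : Family n k} → IsPartialPartition S → Refines S R →
  ∀ {i u a b c d} → R i ∋ a , b → S u ∋ a , b → S u ∋ c , d → R i ∋ c , d
refinement-⊆ (_ , disjoint) refines {i} {u} {a} {b} {c} {d} ri su su' with to (proj₂ (refines i) a b) ri
... | v , selected , sv =
  from (proj₂ (refines i) c d)
    (u , subst (λ w → T (proj₁ (refines i) w)) (disjoint v u a b sv su) selected , su')

module Representatives {A : Set} (E : A → A → Set) (E? : ∀ a b → Dec (E a b))
                       (E-sym : ∀ {a b} → E a b → E b a) (E-refl : ∀ a → E a a) where

  Distinct : List A → Set
  Distinct R = ∀ c d → E (lookup R c) (lookup R d) → c ≡ d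

  Meets : List A → List A → Set
  Meets R L = ∀ a → a ∈ L → ∃[ c ] E (lookup R c) a

  representatives : (L : List A) → Σ (List A) λ R → Distinct R × Meets R L
  representatives [] = [] , (λ ()) , (λ a ())
  representatives (a ∷ L) with representatives L
  ... | R , distinct , meets with any? (λ c → E? (lookup R c) a)
  ...   | yes (c , e) = R , distinct , meets′
    where meets′ : Meets R (a ∷ L)
          meets′ .a (here refl) = c , e
          meets′ b (there b∈L) = meets b b∈L
  ...   | no new = (a ∷ R) , distinct′ , meets′
    where
      distinct′ : Distinct (a ∷ R)
      distinct′ zero    zero    e = refl
      distinct′ zero    (suc d) e = ⊥-elim (new (d , E-sym e))
      distinct′ (suc c) zero    e = ⊥-elim (new (c , e))
      distinct′ (suc c) (suc d) e = cong suc (distinct c d e)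
      meets′ : Meets (a ∷ R) (a ∷ L)
      meets′ .a (here refl) = zero , E-refl a
      meets′ b (there b∈L) = let (c , e) = meets b b∈L in suc c , e

module PairClasses {n : ℕ} (E : Fin n → Fin n → Fin n → Fin n → Set)
                   (E? : ∀ a b a' b' → Dec (E a b a' b'))
                   (E-refl : ∀ a b → E a b a b)
                   (E-sym : ∀ {a b a' b'} → E a b a' b' → E a' b' a b)
                   (E-trans : ∀ {a b a' b' a'' b''} → E a b a' b' → E a' b' a'' b'' → E a b a'' b'')
                   where

  private
    Pair : Set
    Pair = Fin n × Fin n
    E₂ : Pair → Pair → Set
    E₂ (a , b) (a' , b') = E a b a' b'
    open Representatives E₂ (λ p q → E? _ _ _ _) E-sym (λ p → E-refl _ _)
    allPairs : List Pair
    allPairs = cartesianProduct (allFin n) (allFin n)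
    reps : Σ (List Pair) λ R → Distinct R × Meets R allPairs
    reps = representatives allPairs

  -- The classes are kept abstract: only their characterisation below is
  -- used, and the (large) normal forms of the enumeration and of the
  -- decision procedure are never unfolded during type checking.
  abstract
    size : ℕ
    size = length (proj₁ reps)

    src tgt : Fin size → Fin n
    src c = proj₁ (lookup (proj₁ reps) c)
    tgt c = proj₂ (lookup (proj₁ reps) c)

    classes : Family n size
    classes c a b = ⌊ E? (src c) (tgt c) a b ⌋

    classes-char : ∀ {c a b} → (classes c ∋ a , b) ⇔ E (src c) (tgt c) a b
    classes-char {c} {a} {b} = mk⇔ toWitness (fromWitness {a? = E? (src c) (tgt c) a b})

    base-meets : ∀ a b → ∃[ c ] E (src c) (tgt c) a b
    base-meets a b = proj₂ (proj₂ reps) (a , b) (∈-cartesianProduct⁺ (∈-allFin a) (∈-allFin b))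

    base-distinct : ∀ c d → E (src c) (tgt c) (src d) (tgt d) → c ≡ d
    base-distinct = proj₁ (proj₂ reps)

  class-of : ∀ a b → ∃[ c ] classes c ∋ a , b
  class-of a b with base-meets a b
  ... | c , e = c , from classes-char e

  same-class : ∀ {c a b a' b'} → classes c ∋ a , b → classes c ∋ a' , b' → E a b a' b'
  same-class h h' = E-trans (E-sym (to classes-char h)) (to classes-char h')

  classes-partition : IsPartialPartition classes
  classes-partition =
    (λ c → src c , tgt c , from classes-char (E-refl _ _)) ,
    (λ c d a b h h' → base-distinct c d (E-trans (to classes-char h) (E-sym (to classes-char h'))))

module PartialCC {n m : ℕ} {R : Family n m} (pcc : IsPartialCC R) where
  open IsPartialCC pcc

  disjoint : ∀ {i j a b} → R i ∋ a , b → R j ∋ a , b → i ≡ j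
  disjoint = proj₂ partition _ _ _ _

  nonempty : ∀ i → ∃[ a ] ∃[ b ] R i ∋ a , b
  nonempty = proj₁ partition

  converse : Fin m → Fin m
  converse i = proj₁ (symm i)

  converse-intro : ∀ {i a b} → R i ∋ b , a → R (converse i) ∋ a , b
  converse-intro {i} {a} {b} = from (proj₂ (symm i) a b)

  converse-elim : ∀ {i a b} → R (converse i) ∋ a , b → R i ∋ b , a
  converse-elim {i} {a} {b} = to (proj₂ (symm i) a b)

  -- Regularity of intersection numbers: a path a →i c →j b can be moved
  -- to any other pair (a' , b') of the same relation as (a , b).
  transfer : ∀ {t i j a b a' b' c} → R t ∋ a , b → R t ∋ a' , b' → R i ∋ a , c → R j ∋ c , b →
             ∃[ c' ] (R i ∋ a' , c' × R j ∋ c' , b')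
  transfer {t} {i} {j} {a} {b} {a'} {b'} {c} t-ab t-a'b' i-ac j-cb
    with count≢0⇒member (λ x → R i a' x ∧ R j x b')
           (λ no-path → count≢0 (λ x → R i a x ∧ R j x b) c (from T-∧ (i-ac , j-cb))
                          (trans (interReg i j t a b a' b' t-ab t-a'b') no-path))
  ... | c' , path = c' , to T-∧ path

  private
    fiberΣ : ∀ a → ∃[ i ] (T (proj₁ diagUnion i) × R i ∋ a , a)
    fiberΣ a = to (proj₂ diagUnion a a) (≡⇒one refl)

  fiber : Fin n → Fin m
  fiber a = proj₁ (fiberΣ a)

  fiber-refl : ∀ a → R (fiber a) ∋ a , a
  fiber-refl a = proj₂ (proj₂ (fiberΣ a))

  fiber-diagonal : ∀ {a c d} → R (fiber a) ∋ c , d → c ≡ d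
  fiber-diagonal {a} {c} {d} h =
    one⇒≡ (from (proj₂ diagUnion c d) (fiber a , proj₁ (proj₂ (fiberΣ a)) , h))

  fiber-char : ∀ {a c d} → (R (fiber a) ∋ c , d) ⇔ (c ≡ d × fiber c ≡ fiber a)
  fiber-char {a} {c} = mk⇔
    (λ h → fiber-diagonal h ,
           disjoint (fiber-refl c) (subst (λ d → R (fiber a) ∋ c , d) (sym (fiber-diagonal h)) h))
    (λ { (refl , e) → subst (λ x → R x ∋ c , c) e (fiber-refl c) })

  fiber-member : ∀ {a c} → fiber c ≡ fiber a → R (fiber a) ∋ c , c
  fiber-member e = from fiber-char (refl , e)

  fiber-isFiber : ∀ a → IsFiber R (fiber a)
  fiber-isFiber a = (λ c → R (fiber a) c c) , λ c d → mk⇔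
    (λ h → fiber-diagonal h , subst (λ z → R (fiber a) ∋ c , z) (sym (fiber-diagonal h)) h)
    (λ { (refl , p) → p })

  fiber-block : ∀ {i a b a' b'} → R i ∋ a , b → R i ∋ a' , b' → fiber a' ≡ fiber a × fiber b' ≡ fiber b
  fiber-block {i} {a} {b} h h'
    with transfer {j = i} h h' (fiber-refl a) h | transfer {i = i} h h' h (fiber-refl b)
  ... | _ , a'c , _ | _ , _ , cb' =
    proj₂ (to fiber-char a'c) ,
    (let (c≡b' , fc≡fb) = to fiber-char cb' in subst (λ z → fiber z ≡ fiber b) c≡b' fc≡fb)

  inBlock : ∀ {i a b} → R i ∋ a , b → InBlock R (fiber a) (fiber b) (R i)
  inBlock h a' b' h' = fiber-member (proj₁ (fiber-block h h')) , fiber-member (proj₂ (fiber-block h h'))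

  extend-forward : ∀ {i a b a'} → R i ∋ a , b → fiber a' ≡ fiber a → ∃[ b' ] R i ∋ a' , b'
  extend-forward {a = a} h e with transfer (fiber-refl a) (fiber-member e) h (converse-intro h)
  ... | b' , a'b' , _ = b' , a'b'

  extend-backward : ∀ {i a b b'} → R i ∋ a , b → fiber b' ≡ fiber b → ∃[ a' ] R i ∋ a' , b'
  extend-backward {b = b} h e with transfer (fiber-refl b) (fiber-member e) (converse-intro h) h
  ... | a' , _ , a'b' = a' , a'b'

module MatchingConfiguration {n m : ℕ} {M : Family n m} (mc : IsMatchingConfiguration M) where
  open IsMatchingConfiguration mc
  open PartialCC partialCC

  -- Every element of M is a matching: either by definition, or because it
  -- is the only relation on a fiber and hence the diagonal of that fiber.
  semiregular : ∀ i → Functional (M i) × Cofunctional (M i)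
  semiregular i with nonempty i
  ... | a , b , h with matching (fiber a) (fiber b) (fiber-isFiber a) (fiber-isFiber b) (i , inBlock h)
  ...   | inj₁ (_ , matchings) = matching⇒functional (matchings i (inBlock h))
  ...   | inj₂ (fa≡fb , only) =
    (λ h₁ h₂ → trans (sym (diagonal h₁)) (diagonal h₂)) ,
    (λ h₁ h₂ → trans (diagonal h₁) (sym (diagonal h₂)))
    where
    i≡fa : i ≡ fiber a
    i≡fa = only i (subst (λ y → InBlock M (fiber a) y (M i)) (sym fa≡fb) (inBlock h))
    diagonal : ∀ {c d} → M i ∋ c , d → c ≡ d
    diagonal {c} {d} h' = fiber-diagonal {a} (subst (λ x → M x ∋ c , d) i≡fa h')

module Congruence {n m : ℕ} {R : Family n m} (pcc : IsPartialCC R)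
                  (semiregular : ∀ i → Functional (R i) × Cofunctional (R i))
                  (saturated : IsSaturated R) where
  open PartialCC pcc

  private
    functional : ∀ i → Functional (R i)
    functional i = proj₁ (semiregular i)
    cofunctional : ∀ i → Cofunctional (R i)
    cofunctional i = proj₂ (semiregular i)

  Linked : Fin n → Fin n → Set
  Linked ε a = ∃[ i ] R i ∋ ε , a

  -- Saturation applied to the fibers of four points: they have a common source.
  commonSource : ∀ a b c d → ∃[ ε ] (Linked ε a × Linked ε b × Linked ε c × Linked ε d)
  commonSource a b c d
    with saturated (fiber a ∷ fiber b ∷ fiber c ∷ fiber d ∷ []) (s≤s (s≤s (s≤s (s≤s z≤n)))) areFibers
    where
    areFibers : ∀ y → y ∈ (fiber a ∷ fiber b ∷ fiber c ∷ fiber d ∷ []) → IsFiber R y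
    areFibers _ (here refl)                         = fiber-isFiber a
    areFibers _ (there (here refl))                 = fiber-isFiber b
    areFibers _ (there (there (here refl)))         = fiber-isFiber c
    areFibers _ (there (there (there (here refl)))) = fiber-isFiber d
  ... | z , (Λ , z-diag) , adjacent with nonempty z
  ...   | ε , ε' , zεε' =
    ε , linked (here refl) , linked (there (here refl)) ,
    linked (there (there (here refl))) , linked (there (there (there (here refl))))
    where
    zεε : R z ∋ ε , ε
    zεε = subst (λ x → R z ∋ ε , x) (sym (proj₁ (to (z-diag ε ε') zεε'))) zεε'
    linked : ∀ {x} → fiber x ∈ (fiber a ∷ fiber b ∷ fiber c ∷ fiber d ∷ []) → Linked ε x
    linked {x} mem with proj₁ (adjacent (fiber x) mem) ε x zεε (fiber-refl x)
    ... | i , _ , εx = i , εx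

  triangle : ∀ {i j l α β δ α' β' δ'} → R i ∋ α , β → R j ∋ β , δ → R l ∋ α , δ →
             R i ∋ α' , β' → R j ∋ β' , δ' → R l ∋ α' , δ'
  triangle {i} {j} {l} {α' = α'} {β' = β'} {δ' = δ'} αβ βδ αδ α'β' β'δ'
    with extend-forward αδ (proj₁ (fiber-block αβ α'β'))
  ... | δ'' , α'δ'' with transfer αδ α'δ'' αβ βδ
  ...   | β'' , α'β'' , β''δ'' = subst (λ z → R l ∋ α' , z) δ''≡δ' α'δ''
    where
    β''≡β' : β'' ≡ β'
    β''≡β' = functional i α'β'' α'β'
    δ''≡δ' : δ'' ≡ δ'
    δ''≡δ' = functional j (subst (λ z → R j ∋ z , δ'') β''≡β' β''δ'') β'δ'

  record Congruent (α β α' β' : Fin n) : Set where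
    constructor congruent
    field
      γ γ'  : Fin n
      i j   : Fin m
      γα    : R i ∋ γ , α
      γ'α'  : R i ∋ γ' , α'
      γβ    : R j ∋ γ , β
      γ'β'  : R j ∋ γ' , β'

  congruent? : ∀ α β α' β' → Dec (Congruent α β α' β')
  congruent? α β α' β' =
    map′ (λ { (γ , γ' , i , j , h₁ , h₂ , h₃ , h₄) → congruent γ γ' i j h₁ h₂ h₃ h₄ })
         (λ { (congruent γ γ' i j h₁ h₂ h₃ h₄) → γ , γ' , i , j , h₁ , h₂ , h₃ , h₄ })
         (any? λ γ → any? λ γ' → any? λ i → any? λ j →
            T? (R i γ α) ×-dec T? (R i γ' α') ×-dec T? (R j γ β) ×-dec T? (R j γ' β'))

  congruent-refl : ∀ α β → Congruent α β α β
  congruent-refl α β with commonSource α β α β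
  ... | ε , (i , εα) , (j , εβ) , _ = congruent ε ε i j εα εα εβ εβ

  congruent-sym : ∀ {α β α' β'} → Congruent α β α' β' → Congruent α' β' α β
  congruent-sym (congruent γ γ' i j γα γ'α' γβ γ'β') = congruent γ' γ i j γ'α' γα γ'β' γβ

  congruent-swap : ∀ {α β α' β'} → Congruent α β α' β' → Congruent β α β' α'
  congruent-swap (congruent γ γ' i j γα γ'α' γβ γ'β') = congruent γ γ' j i γβ γ'β' γα γ'α'

  congruent-fibers : ∀ {α β α' β'} → Congruent α β α' β' → fiber α' ≡ fiber α × fiber β' ≡ fiber β
  congruent-fibers (congruent γ γ' i j γα γ'α' γβ γ'β') =
    proj₂ (fiber-block γα γ'α') , proj₂ (fiber-block γβ γ'β')

  -- Key lemma: congruence does not depend on the chosen sources.  Any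
  -- sources δ, δ' of α, α' in a common relation k, with (δ , β) ∈ l,
  -- also satisfy (δ' , β') ∈ l.
  congruent-anySource : ∀ {α β α' β' k l δ δ'} → Congruent α β α' β' →
    R k ∋ δ , α → R k ∋ δ' , α' → R l ∋ δ , β → R l ∋ δ' , β'
  congruent-anySource {α} {β} {α'} {β'} {δ = δ} {δ'} (congruent γ γ' i j γα γ'α' γβ γ'β') δα δ'α' δβ
    with commonSource α β γ δ
  ... | ε , (q , εα) , (q' , εβ) , (p , εγ) , (s , εδ) with extend-backward εγ (proj₁ (fiber-block γα γ'α'))
  ...   | ε' , ε'γ' = triangle (converse-intro εδ) εβ δβ δ'ε' ε'β'
    where
    ε'α' : R q ∋ ε' , α'
    ε'α' = triangle εγ γα εα ε'γ' γ'α'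
    ε'β' : R q' ∋ ε' , β'
    ε'β' = triangle εγ γβ εβ ε'γ' γ'β'
    δ'ε' : R (converse s) ∋ δ' , ε'
    δ'ε' = triangle δα (converse-intro εα) (converse-intro εδ) δ'α' (converse-intro ε'α')

  congruent-trans : ∀ {α β α' β' α'' β''} →
    Congruent α β α' β' → Congruent α' β' α'' β'' → Congruent α β α'' β''
  congruent-trans (congruent γ γ' i j γα γ'α' γβ γ'β') κ with extend-backward γ'α' (proj₁ (congruent-fibers κ))
  ... | δ , δα'' = congruent γ δ i j γα δα'' γβ (congruent-anySource κ γ'α' δα'' γ'β')

  congruent-functional : ∀ {α β β'} → Congruent α β α β' → β ≡ β'
  congruent-functional (congruent γ γ' i j γα γ'α γβ γ'β') =
    functional j γβ (subst (λ z → R j ∋ z , _) (sym (cofunctional i γα γ'α)) γ'β')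

  congruent-cofunctional : ∀ {α α' β} → Congruent α β α' β → α ≡ α'
  congruent-cofunctional κ = congruent-functional (congruent-swap κ)

  congruent-extend : ∀ {α β a} → fiber a ≡ fiber α → ∃[ b ] Congruent α β a b
  congruent-extend {α} {β} e with congruent-refl α β
  ... | congruent γ _ i j γα _ γβ _ with extend-backward γα e
  ...   | δ , δa with extend-forward γβ (proj₁ (fiber-block γα δa))
  ...     | b , δb = b , congruent γ δ i j γα δa γβ δb

  congruent-diagonal : ∀ {α α' β'} → Congruent α α α' β' → α' ≡ β'
  congruent-diagonal (congruent γ γ' i j γα γ'α' γα₂ γ'β') =
    functional i γ'α' (subst (λ x → R x ∋ γ' , _) (sym (disjoint γα γα₂)) γ'β')

  congruent-diagonal-char : ∀ {a c d} → Congruent a a c d ⇔ (c ≡ d × fiber c ≡ fiber a)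
  congruent-diagonal-char {a} {c} = mk⇔
    (λ κ → congruent-diagonal κ , proj₁ (congruent-fibers κ))
    (λ { (refl , e) → let (d , κ) = congruent-extend e in
                      subst (λ z → Congruent a a c z) (sym (congruent-diagonal κ)) κ })

  congruent-compose : ∀ {α c α' c' β β'} →
    Congruent α c α' c' → Congruent α β α' β' → Congruent c β c' β'
  congruent-compose {α} {c} {β = β} κ₁ κ₂ with commonSource α c β β
  ... | ε , (_ , εα) , (j , εc) , (j' , εβ) , _ with extend-backward εα (proj₁ (congruent-fibers κ₁))
  ...   | ε' , ε'α' =
    congruent ε ε' j j' εc (congruent-anySource κ₁ εα ε'α' εc) εβ (congruent-anySource κ₂ εα ε'α' εβ)

  congruent-respects : ∀ {i α β α' β'} → R i ∋ α , β → Congruent α β α' β' → R i ∋ α' , β'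
  congruent-respects h (congruent γ γ' k l γα γ'α' γβ γ'β') =
    triangle (converse-intro γα) γβ h (converse-intro γ'α') γ'β'

  open PairClasses Congruent congruent? congruent-refl congruent-sym congruent-trans public

  class-closed : ∀ {c a b a' b'} → classes c ∋ a , b → Congruent a b a' b' → classes c ∋ a' , b'
  class-closed h κ = from classes-char (congruent-trans (to classes-char h) κ)

  classes-diagonal : IsUnionOf one classes
  classes-diagonal = (λ c → one (src c) (tgt c)) , λ a b → mk⇔ (forward a b) backward
    where
    forward : ∀ a b → T (one a b) → ∃[ c ] (T (one (src c) (tgt c)) × classes c ∋ a , b)
    forward a b o = diagonal-class (one⇒≡ o)
      where
      diagonal-class : a ≡ b → ∃[ c ] (T (one (src c) (tgt c)) × classes c ∋ a , b)
      diagonal-class refl =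
        let (c , h) = class-of a a in
        c , ≡⇒one {a = src c} {b = tgt c} (congruent-diagonal (congruent-sym (to classes-char h))) , h
    backward : ∀ {a b} → ∃[ c ] (T (one (src c) (tgt c)) × classes c ∋ a , b) → T (one a b)
    backward {a} {b} (c , o , h) =
      let src≡tgt = one⇒≡ {a = src c} {b = tgt c} o in
      ≡⇒one (congruent-diagonal (subst (λ z → Congruent (src c) z a b) (sym src≡tgt) (to classes-char h)))

  classes-converse : ∀ c → ∃[ d ] (classes d ≐ (classes c *))
  classes-converse c =
    let (d , h) = class-of (tgt c) (src c) in
    d , λ a b → mk⇔
    (λ h' → from classes-char (congruent-swap (same-class h h')))
    (λ h' → from classes-char (congruent-trans (to classes-char h) (congruent-swap (to classes-char h'))))

  -- Intersection numbers of classes are 0 or 1, and a path through two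
  -- classes moves along congruent pairs.
  classes-intersection : ∀ c d t a b a' b' → classes t ∋ a , b → classes t ∋ a' , b' →
    interNum (classes c) (classes d) a b ≡ interNum (classes c) (classes d) a' b'
  classes-intersection c d t a b a' b' h h' =
    count-cong-atMostOne _ _ (unique a b) (unique a' b') (move (same-class h h')) (move (same-class h' h))
    where
    unique : ∀ a b → AtMostOne (λ x → classes c a x ∧ classes d x b)
    unique a b p p' = congruent-functional (same-class (proj₁ (to T-∧ p)) (proj₁ (to T-∧ p')))
    move : ∀ {a b a' b'} → Congruent a b a' b' →
           ∃[ x ] T (classes c a x ∧ classes d x b) → ∃[ x ] T (classes c a' x ∧ classes d x b')
    move {a} κ (x , p) =
      let (ax , xb) = to T-∧ p
          (x' , κ') = congruent-extend {a} {x} (proj₁ (congruent-fibers κ))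
      in x' , from T-∧ (class-closed ax κ' , class-closed xb (congruent-compose κ' κ))

  congruenceCC : IsCC classes
  congruenceCC = record
    { partialCC = record
      { partition = classes-partition ; diagUnion = classes-diagonal
      ; symm = classes-converse ; interReg = classes-intersection }
    ; covers = class-of }

  classes-refine : Refines classes R
  classes-refine i = (λ c → R i (src c) (tgt c)) , λ a b → mk⇔
    (λ h → let (c , hc) = class-of a b in c , congruent-respects h (congruent-sym (to classes-char hc)) , hc)
    (λ { (c , selected , hc) → congruent-respects selected (to classes-char hc) })

module Closure {n m k : ℕ} {M : Family n m} {Tr : Family n k}
               (mc : IsMatchingConfiguration M) (sat : IsSaturated M) (cl : IsCoherentClosure Tr M) where
  open IsMatchingConfiguration mc using (partialCC)
  open PartialCC partialCC
  open Congruence partialCC (MatchingConfiguration.semiregular mc) sat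

  private
    closureCC : IsCC Tr
    closureCC = proj₁ cl
    module T = PartialCC (IsCC.partialCC closureCC)

    closure-⊆ : ∀ {i u a b c d} → M i ∋ a , b → Tr u ∋ a , b → Tr u ∋ c , d → M i ∋ c , d
    closure-⊆ = refinement-⊆ (IsPartialCC.partition (IsCC.partialCC closureCC)) (proj₁ (proj₂ cl))

  -- Every element of T lies in one congruence class: a common source of
  -- (α , β) is transferred inside T to a common source of (α' , β').
  closure-⊆-congruent : ∀ {t α β α' β'} → Tr t ∋ α , β → Tr t ∋ α' , β' → Congruent α β α' β'
  closure-⊆-congruent {α = α} {β} h h' with commonSource α β α β
  ... | γ , (i , γα) , (j , γβ) , _ with IsCC.covers closureCC γ α | IsCC.covers closureCC γ β
  ...   | u , uγα | v , vγβ with T.transfer h h' (T.converse-intro uγα) vγβ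
  ...     | γ' , α'γ' , γ'β' =
    congruent γ γ' i j γα (closure-⊆ γα uγα (T.converse-elim α'γ')) γβ (closure-⊆ γβ vγβ γ'β')

  -- By minimality T is a union of congruence classes, so its elements are
  -- exactly the congruence classes.
  closure-class : ∀ {t α β a b} → Tr t ∋ α , β → (Tr t ∋ a , b) ⇔ Congruent α β a b
  closure-class {t} {α} {β} {a} {b} h = mk⇔ (closure-⊆-congruent h) back
    where
    union : IsUnionOf (Tr t) classes
    union = proj₂ (proj₂ cl) classes congruenceCC classes-refine t
    back : Congruent α β a b → Tr t ∋ a , b
    back κ = let (c , selected , cαβ) = to (proj₂ union α β) h in
             from (proj₂ union a b) (c , selected , class-closed cαβ κ)

  closure-semiregular : ∀ t → IsMatching (Tr t)
  closure-semiregular t = functional⇒matching (Tr t)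
    (λ h h' → congruent-functional (to (closure-class h) h'))
    (λ h h' → congruent-cofunctional (to (closure-class h) h'))

  closure-fiber : ∀ {t a} → Tr t ∋ a , a → Tr t ≐ M (fiber a)
  closure-fiber h c d = ⇔.trans (closure-class h) (⇔.trans congruent-diagonal-char (⇔.sym fiber-char))

  closure-fibers : ∀ Λ → IsFiberSet Tr Λ ⇔ IsFiberSet M Λ
  closure-fibers Λ = mk⇔ forward backward
    where
    forward : IsFiberSet Tr Λ → IsFiberSet M Λ
    forward (t , diag) with T.nonempty t
    ... | a , b , h with to (diag a b) h
    ...   | refl , _ = fiber a , isDiag-resp-≐ (closure-fiber h) diag
    backward : IsFiberSet M Λ → IsFiberSet Tr Λ
    backward (x , diag) with nonempty x
    ... | a , b , h with to (diag a b) h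
    ...   | refl , _ with IsCC.covers closureCC a a
    ...     | t , h' = t , isDiag-resp-≐ (≐-sym (closure-fiber h'))
                             (subst (λ y → IsDiag (M y) Λ) (disjoint h (fiber-refl a)) diag)

corollary4p5 : ∀ {n m k} (M : Family n m) (Tr : Family n k) →
    IsMatchingConfiguration M → IsSaturated M → IsCoherentClosure Tr M →
    (∀ t → IsMatching (Tr t)) × (∀ Λ → IsFiberSet Tr Λ ⇔ IsFiberSet M Λ)
corollary4p5 M Tr mc sat cl = closure-semiregular , closure-fibers
  where open Closure mc sat cl
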